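{- In $\mathbf{IPF}^I$, for every formula $F$ and distinct variables $x,y$ ($y$ not occurring in $F$): $\vdash\exists y\, Ix[F,x=y]\leftrightarrow Ix[F,\exists!x]$.
   Context: $\mathbf{IPF}$ is a natural deduction system of intuitionist positive free logic: a first-order language without function symbols, terms constants and parameters, primitive predicate $\exists!$ ("exists"), identity; standard intuitionist rules for $\land,\rightarrow,\lor,\leftrightarrow$, $\bot E$ to atomic conclusions; $\forall I$ (infer $\forall xA$ from a deduction of $A^x_a$, discharging $\exists!a$, $a$ fresh), $\forall E$ (from $\forall xA$, $\exists!t$ infer $A^x_t$), $\exists I$ (from $A^x_t$, $\exists!t$ infer $\exists xA$), $\exists E$ (from $\exists xA$ and a deduction of $C$ from $A^x_a,\exists!a$ infer $C$, discharging them, $a$ fresh); $=I$: axiom $t=t$; $=E$: from $t_1=t_2$ and $A^x_{t_1}$ infer $A^x_{t_2}$ ($A$ atomic). $\mathbf{IPF}^I$ adds formulas $Ix[F,G]$ ("the $F$ is $G$", binding $x$) with rules ($a,b$ fresh parameters not occurring in $F,G,C$ or other open assumptions of the subdeduction, $a\neq t$): $II$: from $F^x_t,G^x_t,\exists!t$ and a deduction of $a=t$ from $F^x_a,\exists!a$ (discharged) infer $Ix[F,G]$; $IE^{1p}$: from $Ix[F,G]$, $F^x_t$, $\exists!t$, a deduction of $a=t$ from $F^x_a,\exists!a$ and a deduction of $C$ from $F^x_b,G^x_b,\exists!b$ (all discharged) infer $C$; $IE^{2p}$: from $Ix[F,\exists!x],\exists!t_1,\exists!t_2,F^x_{t_1},F^x_{t_2},A^x_{t_1}$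 infer $A^x_{t_2}$ ($A$ atomic); $IE^{3p}$: from $Ix[F,\exists!x]$ and a deduction of $C$ from $F^x_a,\exists!a$ (discharged) infer $C$; $IE^{4p}$: from $Ix[F,x=t_2],\exists!t_1,\exists!t_2,F^x_{t_1},A^x_{t_1}$ infer $A^x_{t_2}$ ($A$ atomic); $IE^{5p}$: from $Ix[F,x=t],\exists!t$ and a deduction of $C$ from $F^x_a,\exists!a$ (discharged) infer $C$. -}

module Defs where

open import Data.Nat using (ℕ; suc)
open import Data.Fin using (Fin; zero; suc)
open import Data.List using (List; []; _∷_; map)
open import Data.List.Relation.Unary.All using (All)
open import Data.List.Membership.Propositional using (_∈_)
open import Data.Product using (_×_)
open import Data.Unit using (⊤)
open import Data.Empty using (⊥)
open import Relation.Binary.PropositionalEquality using (_≡_; _≢_)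

-- Syntax (well-scoped, bound variables as de Bruijn LEVELS).
-- Term n / Formula n : at most n bound variables in scope,
-- level 0 = outermost binder, level n-1 = innermost.
-- Free occurrences are parameters (par a); there are also constants.

data Term (n : ℕ) : Set where
  var : Fin n → Term n
  par : ℕ → Term n
  con : ℕ → Term n

infixr 2 _⇔_
infixr 3 _⇒_
infixr 4 _∨_
infixr 5 _∧_
infix  6 _≐_

data Formula (n : ℕ) : Set where
  rel  : ℕ → List (Term n) → Formula n
  E!   : Term n → Formula n                    -- ∃! t  (existence)
  _≐_  : Term n → Term n → Formula n
  ⊥'   : Formula n
  _∧_ _∨_ _⇒_ _⇔_ : Formula n → Formula n → Formula n
  ∀' ∃' : Formula (suc n) → Formula n          -- ∀x A, ∃x A (x = level n)
  I    : Formula (suc n) → Formula (suc n) → Formula n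

data Atomic {n : ℕ} : Formula n → Set where
  at-rel : ∀ P ts → Atomic (rel P ts)
  at-E!  : ∀ t → Atomic (E! t)
  at-≐   : ∀ s t → Atomic (s ≐ t)
  at-⊥   : Atomic ⊥'

cl : ∀ {n} → Term 0 → Term n
cl (par a) = par a
cl (con c) = con c

subT : ∀ {n} → Term (suc n) → Term 0 → Term n
subT (var zero)    t = cl t
subT (var (suc i)) t = var i
subT (par a)       t = par a
subT (con c)       t = con c

sub : ∀ {n} → Formula (suc n) → Term 0 → Formula n
sub (rel P ts) t = rel P (map (λ s → subT s t) ts)
sub (E! s)     t = E! (subT s t)
sub (s ≐ u)    t = subT s t ≐ subT u t
sub ⊥'         t = ⊥'
sub (A ∧ B)    t = sub A t ∧ sub B t
sub (A ∨ B)    t = sub A t ∨ sub B t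
sub (A ⇒ B)    t = sub A t ⇒ sub B t
sub (A ⇔ B)    t = sub A t ⇔ sub B t
sub (∀' A)     t = ∀' (sub A t)
sub (∃' A)     t = ∃' (sub A t)
sub (I F G)    t = I (sub F t) (sub G t)

_[_] : Formula 1 → Term 0 → Formula 0
A [ t ] = sub A t

wkT : ∀ {n} → Term n → Term (suc n)
wkT (var i) = var (suc i)
wkT (par a) = par a
wkT (con c) = con c

wk : ∀ {n} → Formula n → Formula (suc n)
wk (rel P ts) = rel P (map wkT ts)
wk (E! s)     = E! (wkT s)
wk (s ≐ u)    = wkT s ≐ wkT u
wk ⊥'         = ⊥'
wk (A ∧ B)    = wk A ∧ wk B
wk (A ∨ B)    = wk A ∨ wk B
wk (A ⇒ B)    = wk A ⇒ wk B
wk (A ⇔ B)    = wk A ⇔ wk B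
wk (∀' A)     = ∀' (wk A)
wk (∃' A)     = ∃' (wk A)
wk (I F G)    = I (wk F) (wk G)

_#T_ : ∀ {n} → ℕ → Term n → Set
a #T var i = ⊤
a #T par b = a ≢ b
a #T con c = ⊤

_#_ : ∀ {n} → ℕ → Formula n → Set
a # rel P ts = All (a #T_) ts
a # E! s     = a #T s
a # (s ≐ u)  = a #T s × a #T u
a # ⊥'       = ⊤
a # (A ∧ B)  = a # A × a # B
a # (A ∨ B)  = a # A × a # B
a # (A ⇒ B)  = a # A × a # B
a # (A ⇔ B)  = a # A × a # B
a # ∀' A     = a # A
a # ∃' A     = a # A
a # I F G    = a # F × a # G

_#Γ_ : ℕ → List (Formula 0) → Set
a #Γ Γ = All (a #_) Γ

Ctx : Set
Ctx = List (Formula 0)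

infix 1 _⊢_

data _⊢_ (Γ : Ctx) : Formula 0 → Set where
  ass  : ∀ {A} → A ∈ Γ → Γ ⊢ A
  ∧I   : ∀ {A B} → Γ ⊢ A → Γ ⊢ B → Γ ⊢ A ∧ B
  ∧E₁  : ∀ {A B} → Γ ⊢ A ∧ B → Γ ⊢ A
  ∧E₂  : ∀ {A B} → Γ ⊢ A ∧ B → Γ ⊢ B
  ⇒I   : ∀ {A B} → A ∷ Γ ⊢ B → Γ ⊢ A ⇒ B
  ⇒E   : ∀ {A B} → Γ ⊢ A ⇒ B → Γ ⊢ A → Γ ⊢ B
  ∨I₁  : ∀ {A B} → Γ ⊢ A → Γ ⊢ A ∨ B
  ∨I₂  : ∀ {A B} → Γ ⊢ B → Γ ⊢ A ∨ B
  ∨E   : ∀ {A B C} → Γ ⊢ A ∨ B → A ∷ Γ ⊢ C → B ∷ Γ ⊢ C → Γ ⊢ C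
  ⇔I   : ∀ {A B} → A ∷ Γ ⊢ B → B ∷ Γ ⊢ A → Γ ⊢ A ⇔ B
  ⇔E₁  : ∀ {A B} → Γ ⊢ A ⇔ B → Γ ⊢ A → Γ ⊢ B
  ⇔E₂  : ∀ {A B} → Γ ⊢ A ⇔ B → Γ ⊢ B → Γ ⊢ A
  ⊥E   : ∀ {A} → Atomic A → Γ ⊢ ⊥' → Γ ⊢ A
  ∀I   : ∀ {A} a → a # A → a #Γ Γ →
         E! (par a) ∷ Γ ⊢ A [ par a ] → Γ ⊢ ∀' A
  ∀E   : ∀ {A} t → Γ ⊢ ∀' A → Γ ⊢ E! t → Γ ⊢ A [ t ]
  ∃I   : ∀ {A} t → Γ ⊢ A [ t ] → Γ ⊢ E! t → Γ ⊢ ∃' A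
  ∃E   : ∀ {A C} a → a # A → a # C → a #Γ Γ →
         Γ ⊢ ∃' A → A [ par a ] ∷ E! (par a) ∷ Γ ⊢ C → Γ ⊢ C
  =I   : ∀ t → Γ ⊢ t ≐ t
  =E   : ∀ {A} t₁ t₂ → Atomic A →
         Γ ⊢ t₁ ≐ t₂ → Γ ⊢ A [ t₁ ] → Γ ⊢ A [ t₂ ]
  II   : ∀ {F G} t a → a # F → a # G → a #Γ Γ → par a ≢ t →
         Γ ⊢ F [ t ] → Γ ⊢ G [ t ] → Γ ⊢ E! t →
         F [ par a ] ∷ E! (par a) ∷ Γ ⊢ par a ≐ t →
         Γ ⊢ I F G
  IE1p : ∀ {F G C} t a b →
         a # F → a # G → a # C → a #Γ Γ → par a ≢ t →
         b # F → b # G → b # C → b #Γ Γ →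
         Γ ⊢ I F G → Γ ⊢ F [ t ] → Γ ⊢ E! t →
         F [ par a ] ∷ E! (par a) ∷ Γ ⊢ par a ≐ t →
         F [ par b ] ∷ G [ par b ] ∷ E! (par b) ∷ Γ ⊢ C →
         Γ ⊢ C
  IE2p : ∀ {F A} t₁ t₂ → Atomic A →
         Γ ⊢ I F (E! (var zero)) → Γ ⊢ E! t₁ → Γ ⊢ E! t₂ →
         Γ ⊢ F [ t₁ ] → Γ ⊢ F [ t₂ ] → Γ ⊢ A [ t₁ ] → Γ ⊢ A [ t₂ ]
  IE3p : ∀ {F C} a → a # F → a # C → a #Γ Γ →
         Γ ⊢ I F (E! (var zero)) →
         F [ par a ] ∷ E! (par a) ∷ Γ ⊢ C → Γ ⊢ C
  IE4p : ∀ {F A} t₁ t₂ → Atomic A →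
         Γ ⊢ I F (var zero ≐ cl t₂) → Γ ⊢ E! t₁ → Γ ⊢ E! t₂ →
         Γ ⊢ F [ t₁ ] → Γ ⊢ A [ t₁ ] → Γ ⊢ A [ t₂ ]
  IE5p : ∀ {F C} t a → a # F → a # C → a #Γ Γ →
         Γ ⊢ I F (var zero ≐ cl t) → Γ ⊢ E! t →
         F [ par a ] ∷ E! (par a) ∷ Γ ⊢ C → Γ ⊢ C

{-# OPTIONS --safe #-}
-- Both formulas say that F has a unique witness, and the rules for I
-- interconvert the two forms of uniqueness. If the F is a, then every
-- existing witness of F equals a (IE4p), so any two witnesses are equal and
-- II applies to the witness b supplied by IE5p. Conversely, if the F exists,
-- any two witnesses are equal (IE2p), so for the witness a supplied by IE3p
-- II yields that the F is a. Both equalities come from the transport rules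
-- IE2p/IE4p applied to an identity atom.
module Submission where

open import Defs
open import Data.List using ([]; _∷_; List)
open import Data.List.Properties using (map-∘; map-cong; map-id)
open import Data.List.Relation.Unary.All using (All; []; _∷_)
open import Data.List.Relation.Unary.Any using (here; there)
open import Data.Fin using (zero; suc)
open import Data.Nat using (ℕ; suc; _⊔_; _≤_)
open import Data.Nat.Properties using (m⊔n≤o⇒m≤o; m⊔n≤o⇒n≤o; <⇒≢; ≤-refl)
open import Data.Product using (∃; _×_; _,_)
open import Data.Unit using (tt)
open import Relation.Binary.PropositionalEquality
  using (_≡_; _≢_; refl; sym; trans; cong; cong₂; subst)

-- bound A exceeds every parameter of A, so boundΓ Δ is fresh for all of Δ;
-- each eigenparameter below is fresh for the conclusion and the current
-- assumptions listed in one Δ.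

boundT : ∀ {n} → Term n → ℕ
boundT (var i) = 0
boundT (par a) = suc a
boundT (con c) = 0

boundTs : ∀ {n} → List (Term n) → ℕ
boundTs []       = 0
boundTs (t ∷ ts) = boundT t ⊔ boundTs ts

bound : ∀ {n} → Formula n → ℕ
bound (rel P ts) = boundTs ts
bound (E! s)     = boundT s
bound (s ≐ u)    = boundT s ⊔ boundT u
bound ⊥'         = 0
bound (A ∧ B)    = bound A ⊔ bound B
bound (A ∨ B)    = bound A ⊔ bound B
bound (A ⇒ B)    = bound A ⊔ bound B
bound (A ⇔ B)    = bound A ⊔ bound B
bound (∀' A)     = bound A
bound (∃' A)     = bound A
bound (I F G)    = bound F ⊔ bound G

boundΓ : Ctx → ℕ
boundΓ []      = 0
boundΓ (A ∷ Γ) = bound A ⊔ boundΓ Γ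

boundT≤⇒#T : ∀ {n k} (t : Term n) → boundT t ≤ k → k #T t
boundT≤⇒#T (var i) _   = tt
boundT≤⇒#T (par a) a<k = λ k≡a → <⇒≢ a<k (sym k≡a)
boundT≤⇒#T (con c) _   = tt

boundTs≤⇒#Ts : ∀ {n k} (ts : List (Term n)) → boundTs ts ≤ k → All (k #T_) ts
boundTs≤⇒#Ts []       _ = []
boundTs≤⇒#Ts (t ∷ ts) p =
  boundT≤⇒#T t (m⊔n≤o⇒m≤o _ _ p) ∷ boundTs≤⇒#Ts ts (m⊔n≤o⇒n≤o _ _ p)

mutual
  bound≤⇒# : ∀ {n k} (A : Formula n) → bound A ≤ k → k # A
  bound≤⇒# (rel P ts) p = boundTs≤⇒#Ts ts p
  bound≤⇒# (E! s)     p = boundT≤⇒#T s p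
  bound≤⇒# (s ≐ u)    p = boundT≤⇒#T s (m⊔n≤o⇒m≤o _ _ p) , boundT≤⇒#T u (m⊔n≤o⇒n≤o _ _ p)
  bound≤⇒# ⊥'         p = tt
  bound≤⇒# (A ∧ B)    p = bound⊔≤⇒# A B p
  bound≤⇒# (A ∨ B)    p = bound⊔≤⇒# A B p
  bound≤⇒# (A ⇒ B)    p = bound⊔≤⇒# A B p
  bound≤⇒# (A ⇔ B)    p = bound⊔≤⇒# A B p
  bound≤⇒# (∀' A)     p = bound≤⇒# A p
  bound≤⇒# (∃' A)     p = bound≤⇒# A p
  bound≤⇒# (I F G)    p = bound⊔≤⇒# F G p

  bound⊔≤⇒# : ∀ {n k} (A B : Formula n) → bound A ⊔ bound B ≤ k → k # A × k # B
  bound⊔≤⇒# A B p = bound≤⇒# A (m⊔n≤o⇒m≤o _ _ p) , bound≤⇒# B (m⊔n≤o⇒n≤o _ _ p)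

boundΓ≤⇒#Γ : ∀ {k} (Γ : Ctx) → boundΓ Γ ≤ k → k #Γ Γ
boundΓ≤⇒#Γ []      _ = []
boundΓ≤⇒#Γ (A ∷ Γ) p = bound≤⇒# A (m⊔n≤o⇒m≤o _ _ p) ∷ boundΓ≤⇒#Γ Γ (m⊔n≤o⇒n≤o _ _ p)

∃-fresh : (Δ : Ctx) → ∃ λ a → a #Γ Δ
∃-fresh Δ = boundΓ Δ , boundΓ≤⇒#Γ Δ ≤-refl

#T⇒par≢ : ∀ {a} (t : Term 0) → a #T t → par a ≢ t
#T⇒par≢ (par b) a≢b refl = a≢b refl
#T⇒par≢ (con c) _    ()

sub-wkT : ∀ {n} (s : Term n) (t : Term 0) → subT (wkT s) t ≡ s
sub-wkT (var i) t = refl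
sub-wkT (par a) t = refl
sub-wkT (con c) t = refl

sub-wk : ∀ {n} (A : Formula n) (t : Term 0) → sub (wk A) t ≡ A
sub-wk (rel P ts) t = cong (rel P)
  (trans (sym (map-∘ ts)) (trans (map-cong (λ s → sub-wkT s t) ts) (map-id ts)))
sub-wk (E! s)     t = cong E! (sub-wkT s t)
sub-wk (s ≐ u)    t = cong₂ _≐_ (sub-wkT s t) (sub-wkT u t)
sub-wk ⊥'         t = refl
sub-wk (A ∧ B)    t = cong₂ _∧_ (sub-wk A t) (sub-wk B t)
sub-wk (A ∨ B)    t = cong₂ _∨_ (sub-wk A t) (sub-wk B t)
sub-wk (A ⇒ B)    t = cong₂ _⇒_ (sub-wk A t) (sub-wk B t)
sub-wk (A ⇔ B)    t = cong₂ _⇔_ (sub-wk A t) (sub-wk B t)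
sub-wk (∀' A)     t = cong ∀' (sub-wk A t)
sub-wk (∃' A)     t = cong ∃' (sub-wk A t)
sub-wk (I F G)    t = cong₂ I (sub-wk F t) (sub-wk G t)

cl-id : (t : Term 0) → cl t ≡ t
cl-id (par a) = refl
cl-id (con c) = refl

sub-≐-cl : (s t : Term 0) → (var zero ≐ cl s) [ t ] ≡ (t ≐ s)
sub-≐-cl (par a) (par b) = refl
sub-≐-cl (par a) (con d) = refl
sub-≐-cl (con c) (par b) = refl
sub-≐-cl (con c) (con d) = refl

infix 7 the_is_

E!the : Formula 1 → Formula 0
E!the F = I F (E! (var zero))

the_is_ : Formula 1 → Term 0 → Formula 0
the F is t = I F (var zero ≐ cl t)

∃the : Formula 1 → Formula 0
∃the F = ∃' (I (wk F) (var (suc zero) ≐ var zero))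

module _ {Γ : Ctx} where

  E!-cl : ∀ t → Γ ⊢ E! t → Γ ⊢ E! (cl t)
  E!-cl t = subst (λ u → Γ ⊢ E! u) (sym (cl-id t))

  =I-cl : ∀ t → Γ ⊢ (var zero ≐ cl t) [ t ]
  =I-cl t = subst (Γ ⊢_) (sym (sub-≐-cl t t)) (=I t)

  ≐-euclidean : ∀ s t u → Γ ⊢ t ≐ s → Γ ⊢ t ≐ u → Γ ⊢ s ≐ u
  ≐-euclidean s t u t≐s t≐u =
    subst (Γ ⊢_) (sub-≐-cl u s)
      (=E {A = var zero ≐ cl u} t s (at-≐ _ _) t≐s
        (subst (Γ ⊢_) (sym (sub-≐-cl u t)) t≐u))

  -- Leibniz in the converse direction: instantiate with the atom "x = s".
  transport⇒≐ : ∀ s t → (∀ {A} → Atomic A → Γ ⊢ A [ s ] → Γ ⊢ A [ t ]) → Γ ⊢ t ≐ s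
  transport⇒≐ s t transport =
    subst (Γ ⊢_) (sub-≐-cl s t) (transport {A = var zero ≐ cl s} (at-≐ _ _) (=I-cl s))

  E!the-unique : ∀ {F} s t → Γ ⊢ E!the F → Γ ⊢ E! s → Γ ⊢ E! t →
                 Γ ⊢ F [ s ] → Γ ⊢ F [ t ] → Γ ⊢ t ≐ s
  E!the-unique s t E!theF E!s E!t Fs Ft =
    transport⇒≐ s t (λ {A} at → IE2p {A = A} s t at E!theF E!s E!t Fs Ft)

  the-is-unique : ∀ {F} s t → Γ ⊢ the F is t → Γ ⊢ E! s → Γ ⊢ E! t →
                  Γ ⊢ F [ s ] → Γ ⊢ t ≐ s
  the-is-unique s t theFt E!s E!t Fs =
    transport⇒≐ s t (λ {A} at → IE4p {A = A} s t at theFt E!s E!t Fs)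

pattern #0 = here refl
pattern #1 = there #0
pattern #2 = there #1
pattern #3 = there #2
pattern #4 = there #3
pattern #5 = there #4

the-is,F⊢E!the : ∀ {Γ} (F : Formula 1) (s t : Term 0) →
                 F [ s ] ∷ E! s ∷ the F is t ∷ E! t ∷ Γ ⊢ E!the F
the-is,F⊢E!the {Γ} F s t with ∃-fresh (E!the F ∷ F [ s ] ∷ E! s ∷ the F is t ∷ E! t ∷ Γ)
... | c , ((c#F , _) ∷ c#Γ@(_ ∷ c#s ∷ _)) =
  II s c c#F tt c#Γ (#T⇒par≢ s c#s) (ass #0) (E!-cl s (ass #1)) (ass #1)
    (≐-euclidean (par c) t s
      (the-is-unique (par c) t (ass #4) (ass #1) (ass #5) (ass #0))
      (the-is-unique s t (ass #4) (ass #3) (ass #5) (ass #2)))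

the-is⊢E!the : ∀ {Γ} (F : Formula 1) (t : Term 0) → the F is t ∷ E! t ∷ Γ ⊢ E!the F
the-is⊢E!the {Γ} F t with ∃-fresh (E!the F ∷ the F is t ∷ E! t ∷ Γ)
... | b , (b#C ∷ b#Γ@((b#F , _) ∷ _)) =
  IE5p t b b#F b#C b#Γ (ass #0) (ass #1) (the-is,F⊢E!the F (par b) t)

E!the,F⊢the-is : ∀ {Γ} (F : Formula 1) (t : Term 0) →
                 F [ t ] ∷ E! t ∷ E!the F ∷ Γ ⊢ the F is t
E!the,F⊢the-is {Γ} F t with ∃-fresh (the F is t ∷ F [ t ] ∷ E! t ∷ E!the F ∷ Γ)
... | c , ((c#F , c#G) ∷ c#Γ@(_ ∷ c#t ∷ _)) =
  II t c c#F c#G c#Γ (#T⇒par≢ t c#t) (ass #0) (=I-cl t) (ass #1)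
    (E!the-unique t (par c) (ass #4) (ass #3) (ass #1) (ass #2) (ass #0))

∃the⊢E!the : ∀ {Γ} (F : Formula 1) → ∃the F ∷ Γ ⊢ E!the F
∃the⊢E!the {Γ} F with ∃-fresh (E!the F ∷ ∃the F ∷ Γ)
... | a , (a#C ∷ a#Γ@(a#A ∷ _)) =
  ∃E a a#A a#C a#Γ (ass #0)
    (subst (λ X → I X (var zero ≐ par a) ∷ E! (par a) ∷ ∃the F ∷ Γ ⊢ E!the F)
      (sym (sub-wk F (par a))) (the-is⊢E!the F (par a)))

E!the⊢∃the : ∀ {Γ} (F : Formula 1) → E!the F ∷ Γ ⊢ ∃the F
E!the⊢∃the {Γ} F with ∃-fresh (∃the F ∷ E!the F ∷ Γ)
... | a , (a#C ∷ a#Γ@((a#F , _) ∷ _)) =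
  IE3p a a#F a#C a#Γ (ass #0)
    (∃I (par a)
      (subst (λ X → F [ par a ] ∷ E! (par a) ∷ E!the F ∷ Γ ⊢ I X (var zero ≐ par a))
        (sym (sub-wk F (par a))) (E!the,F⊢the-is F (par a)))
      (ass #1))

mainTheorem14 : (F : Formula 1) →
    [] ⊢ (∃' (I (wk F) (var (suc zero) ≐ var zero)) ⇔ I F (E! (var zero)))
mainTheorem14 F = ⇔I (∃the⊢E!the F) (E!the⊢∃the F)
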